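{- There is a first-order formula $\varphi_{\mathrm{BitR}}(x,z)$ over the vocabulary $\{<,\sqsubset,C,Q\}$ such that for every $n\in\mathbb{N}$ and all $x,z\in[n]$, $([n],<^n,\sqsubset^n,C^n,Q^n)\models\varphi_{\mathrm{BitR}}(x,z)$ iff the $r(z)$-th bit of the binary representation of $x$ is $1$.
   Context: $\mathbb{N}=\{0,1,2,\dots\}$, $[n]=\{0,\dots,n\}$; for a relation $P$ on $\mathbb{N}$, $P^n$ is its restriction to $[n]$. Bits are numbered from the least significant bit, which is bit $0$. For $i\in\mathbb{N}$ let $q_i=i(i+1)/2$. For $x\in\mathbb{N}$ let $c(x)=\max\{i: q_i\le x\}$ and $r(x)=x-q_{c(x)}$. $<$ is the usual order; $x\sqsubset y$ iff $r(x)<r(y)$, or $r(x)=r(y)$ and $c(x)<c(y)$. $C=\{x: 2\nmid\lfloor (c(x)+1)/2^{r(x)}\rfloor\}$ and $Q=\{x: 2\nmid\lfloor q_{c(x)+1}/2^{r(x)}\rfloor\}$. -}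

module Defs where

open import Data.Nat using (ℕ; zero; suc; _+_; _*_; _∸_; _^_; _≤_; _<_; _≤?_)
open import Data.Nat.Properties using (m^n≢0)
open import Data.Nat.DivMod using (_/_)
open import Data.Nat.Divisibility using (_∣_)
open import Data.Fin using (Fin)
open import Data.Vec using (Vec; _∷_; lookup)
open import Data.Product using (_×_; Σ)
open import Data.Sum using (_⊎_)
open import Data.Empty using (⊥)
open import Relation.Nullary using (¬_; yes; no)
open import Relation.Binary.PropositionalEquality using (_≡_)

q : ℕ → ℕ
q i = (i * suc i) / 2

maxQ≤ : ℕ → ℕ → ℕ
maxQ≤ x zero = zero
maxQ≤ x (suc k) with q (suc k) ≤? x
... | yes _ = suc k
... | no _ = maxQ≤ x k

-- c(x) = max { i : q_i ≤ x }; any such i satisfies i ≤ q_i ≤ x, so searching i ≤ x suffices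
c : ℕ → ℕ
c x = maxQ≤ x x

r : ℕ → ℕ
r x = x ∸ q (c x)

_/2^_ : ℕ → ℕ → ℕ
m /2^ k = _/_ m (2 ^ k) {{m^n≢0 2 k}}

_⊏_ : ℕ → ℕ → Set
x ⊏ y = (r x < r y) ⊎ ((r x ≡ r y) × (c x < c y))

C : ℕ → Set
C x = ¬ (2 ∣ ((c x + 1) /2^ r x))

Q : ℕ → Set
Q x = ¬ (2 ∣ (q (c x + 1) /2^ r x))

BitIs1 : ℕ → ℕ → Set
BitIs1 x k = ¬ (2 ∣ (x /2^ k))

-- First-order formulas over the vocabulary {<, ⊏, C, Q} (with equality),
-- with free variables indexed by Fin k (de Bruijn style).
data Formula (k : ℕ) : Set where
  _≐_  : Fin k → Fin k → Formula k
  _≺_  : Fin k → Fin k → Formula k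
  _⊏'_ : Fin k → Fin k → Formula k
  C'   : Fin k → Formula k
  Q'   : Fin k → Formula k
  ⊥'   : Formula k
  ¬'_  : Formula k → Formula k
  _∧'_ : Formula k → Formula k → Formula k
  _∨'_ : Formula k → Formula k → Formula k
  _⇒'_ : Formula k → Formula k → Formula k
  ∀'_  : Formula (suc k) → Formula k
  ∃'_  : Formula (suc k) → Formula k

-- Quantifiers range over [n] = {0,…,n}; relations are the restrictions to [n].
Sat : ∀ {k} → ℕ → Vec ℕ k → Formula k → Set
Sat n ρ (i ≐ j)  = lookup ρ i ≡ lookup ρ j
Sat n ρ (i ≺ j)  = lookup ρ i < lookup ρ j
Sat n ρ (i ⊏' j) = lookup ρ i ⊏ lookup ρ j
Sat n ρ (C' i)   = C (lookup ρ i)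
Sat n ρ (Q' i)   = Q (lookup ρ i)
Sat n ρ ⊥'       = ⊥
Sat n ρ (¬' φ)   = ¬ Sat n ρ φ
Sat n ρ (φ ∧' ψ) = Sat n ρ φ × Sat n ρ ψ
Sat n ρ (φ ∨' ψ) = Sat n ρ φ ⊎ Sat n ρ ψ
Sat n ρ (φ ⇒' ψ) = Sat n ρ φ → Sat n ρ ψ
Sat n ρ (∀' φ)   = (a : ℕ) → a ≤ n → Sat n (a ∷ ρ) φ
Sat n ρ (∃' φ)   = Σ ℕ (λ a → a ≤ n × Sat n (a ∷ ρ) φ)

-- Write x = q (c x) + r x with r x ≤ c x and view u as the point in row c u and column r u of a
-- triangle: < enumerates the triangle row by row, ⊏ column by column. From the two orders one defines
-- the row starts, equality and succession of rows, and equality and order of columns. Bit j of q (c x)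
-- is the Q-bit of the point in the row above x and column j, and bit j of r x is the C-bit of the point
-- in row r x − 1 and column j. Bit r z of x is the xor of these two bits at j = r z with the ripple
-- carry, and a carry into position r z is first-order: some lower column generates one and every
-- column strictly in between propagates it.

module Submission where

open import Defs
open import Data.Nat using (ℕ; _≤_)
open import Data.Vec using (_∷_; [])
open import Data.Product using (Σ)
open import Function.Bundles using (_⇔_)

open import Data.Bool using (Bool; true; false; T; _xor_)
open import Data.Empty using (⊥; ⊥-elim)
open import Data.Fin using (Fin) renaming (zero to fz; suc to fs)
open import Data.Nat using (zero; suc; _+_; _*_; _∸_; _^_; _<_; _≡ᵇ_; _<?_; _≤?_; z≤n; s≤s; z<s)
open import Data.Nat.DivMod
open import Data.Nat.Divisibility using (_∣_; divides; m%n≡0⇒n∣m; n∣m⇒m%n≡0)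
open import Data.Nat.Properties
open import Data.Nat.Tactic.RingSolver using (solve-∀)
open import Data.Product using (∃-syntax; _×_; _,_; proj₁; proj₂)
open import Data.Sum using (_⊎_; inj₁; inj₂)
import Data.Sum as Sum
open import Data.Vec using (Vec; lookup)
open import Data.Vec.Relation.Unary.All using (All; []; _∷_)
open import Data.Vec.Relation.Unary.All.Properties using (lookup⁺)
open import Function.Bundles using (mk⇔; Equivalence)
open import Function.Properties.Equivalence using () renaming (sym to ⇔-sym; trans to ⇔-trans)
open import Relation.Binary using (tri<; tri≈; tri>)
open import Relation.Binary.PropositionalEquality
open import Relation.Nullary using (¬_; yes; no)

open Equivalence using (to; from)

-- Triangular coordinates

pair : ℕ → ℕ → ℕ
pair a b = q a + b

q-suc : ∀ i → q (suc i) ≡ q i + suc i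
q-suc i = begin
  suc i * suc (suc i) / 2      ≡⟨ /-congˡ (expand i) ⟩
  (i * suc i + suc i * 2) / 2  ≡⟨ +-distrib-/-∣ʳ (i * suc i) (divides (suc i) refl) ⟩
  q i + suc i * 2 / 2          ≡⟨ cong (q i +_) (m*n/n≡m (suc i) 2) ⟩
  q i + suc i                  ∎
  where
  open ≡-Reasoning
  expand : ∀ i → suc i * suc (suc i) ≡ i * suc i + suc i * 2
  expand = solve-∀

q-mono-≤ : ∀ {a b} → a ≤ b → q a ≤ q b
q-mono-≤ z≤n = z≤n
q-mono-≤ {suc a} {suc b} (s≤s a≤b) =
  subst₂ _≤_ (sym (q-suc a)) (sym (q-suc b)) (+-mono-≤ (q-mono-≤ a≤b) (s≤s a≤b))

n≤q[n] : ∀ n → n ≤ q n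
n≤q[n] zero = z≤n
n≤q[n] (suc n) = subst (suc n ≤_) (sym (q-suc n)) (m≤n+m (suc n) (q n))

pair<q[1+a] : ∀ {a b} → b ≤ a → pair a b < q (suc a)
pair<q[1+a] {a} {b} b≤a = subst (pair a b <_) (sym (q-suc a)) (+-monoʳ-< (q a) (s≤s b≤a))

pair-<-lex : ∀ {a b a′ b′} → b ≤ a → a < a′ ⊎ a ≡ a′ × b < b′ → pair a b < pair a′ b′
pair-<-lex {a′ = a′} {b′} b≤a (inj₁ a<a′) =
  <-≤-trans (pair<q[1+a] b≤a) (≤-trans (q-mono-≤ a<a′) (m≤m+n (q a′) b′))
pair-<-lex {a} _ (inj₂ (refl , b<b′)) = +-monoʳ-< (q a) b<b′

maxQ≤-pair : ∀ {a b} → b ≤ a → ∀ k → a ≤ k → maxQ≤ (pair a b) k ≡ a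
maxQ≤-pair b≤a zero z≤n = refl
maxQ≤-pair {a} {b} b≤a (suc k) a≤1+k with q (suc k) ≤? pair a b | m≤n⇒m<n∨m≡n a≤1+k
... | yes _   | inj₂ a≡1+k       = sym a≡1+k
... | yes q≤u | inj₁ a<1+k       = ⊥-elim (<⇒≱ (<-≤-trans (pair<q[1+a] b≤a) (q-mono-≤ a<1+k)) q≤u)
... | no _    | inj₁ (s≤s a≤k)   = maxQ≤-pair b≤a k a≤k
... | no q≰u  | inj₂ refl        = ⊥-elim (q≰u (m≤m+n (q a) b))

c-pair : ∀ {a b} → b ≤ a → c (pair a b) ≡ a
c-pair {a} {b} b≤a = maxQ≤-pair b≤a (pair a b) (≤-trans (n≤q[n] a) (m≤m+n (q a) b))

r-pair : ∀ {a b} → b ≤ a → r (pair a b) ≡ b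
r-pair {a} {b} b≤a = begin
  pair a b ∸ q (c (pair a b))  ≡⟨ cong (λ t → pair a b ∸ q t) (c-pair b≤a) ⟩
  q a + b ∸ q a                ≡⟨ m+n∸m≡n (q a) b ⟩
  b                            ∎
  where open ≡-Reasoning

pair-surjective : ∀ u → ∃[ a ] ∃[ b ] b ≤ a × pair a b ≡ u
pair-surjective zero = 0 , 0 , z≤n , refl
pair-surjective (suc u) with pair-surjective u
... | a , b , b≤a , refl with m≤n⇒m<n∨m≡n b≤a
...   | inj₁ b<a  = a , suc b , b<a , +-suc (q a) b
...   | inj₂ refl = suc b , 0 , z≤n , trans (+-identityʳ _) (trans (q-suc b) (+-suc (q b) b))

pair-c-r : ∀ u → pair (c u) (r u) ≡ u
pair-c-r u with pair-surjective u
... | a , b , b≤a , refl = cong₂ pair (c-pair b≤a) (r-pair b≤a)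

r≤c : ∀ u → r u ≤ c u
r≤c u with pair-surjective u
... | a , b , b≤a , refl = subst₂ _≤_ (sym (r-pair b≤a)) (sym (c-pair b≤a)) b≤a

c-r-injective : ∀ {u v} → c u ≡ c v → r u ≡ r v → u ≡ v
c-r-injective {u} {v} cu≡cv ru≡rv =
  trans (sym (pair-c-r u)) (trans (cong₂ pair cu≡cv ru≡rv) (pair-c-r v))

Lex : ℕ → ℕ → Set
Lex u v = c u < c v ⊎ c u ≡ c v × r u < r v

lex⇒< : ∀ {u v} → Lex u v → u < v
lex⇒< {u} {v} h = subst₂ _<_ (pair-c-r u) (pair-c-r v) (pair-<-lex (r≤c u) h)

<⇒lex : ∀ {u v} → u < v → Lex u v
<⇒lex {u} {v} u<v with <-cmp (c u) (c v)
... | tri< cu<cv _ _ = inj₁ cu<cv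
... | tri> _ _ cv<cu = ⊥-elim (<-asym u<v (lex⇒< (inj₁ cv<cu)))
... | tri≈ _ cu≡cv _ with <-cmp (r u) (r v)
...   | tri< ru<rv _ _ = inj₂ (cu≡cv , ru<rv)
...   | tri≈ _ ru≡rv _ = ⊥-elim (<-irrefl (c-r-injective cu≡cv ru≡rv) u<v)
...   | tri> _ _ rv<ru = ⊥-elim (<-asym u<v (lex⇒< (inj₂ (sym cu≡cv , rv<ru))))

c-mono-≤ : ∀ {u v} → u ≤ v → c u ≤ c v
c-mono-≤ u≤v with m≤n⇒m<n∨m≡n u≤v
... | inj₂ refl = ≤-refl
... | inj₁ u<v with <⇒lex u<v
...   | inj₁ cu<cv       = <⇒≤ cu<cv
...   | inj₂ (cu≡cv , _) = ≤-reflexive cu≡cv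

pair-≤ : ∀ {a b u} → a ≤ c u → b ≤ r u → pair a b ≤ u
pair-≤ {u = u} a≤cu b≤ru = subst (_ ≤_) (pair-c-r u) (+-mono-≤ (q-mono-≤ a≤cu) b≤ru)

pair-< : ∀ {a b u} → b ≤ a → a < c u → pair a b < u
pair-< {u = u} b≤a a<cu = subst (_ <_) (pair-c-r u) (pair-<-lex b≤a (inj₁ a<cu))

suc-within-row : ∀ p → r p < c p → c (suc p) ≡ c p × r (suc p) ≡ suc (r p)
suc-within-row p rp<cp =
  subst (λ t → c t ≡ c p × r t ≡ suc (r p)) sp (c-pair rp<cp , r-pair rp<cp)
  where sp : pair (c p) (suc (r p)) ≡ suc p
        sp = trans (+-suc (q (c p)) (r p)) (cong suc (pair-c-r p))

suc-diagonal : ∀ a → suc (pair a a) ≡ pair (suc a) 0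
suc-diagonal a = trans (sym (+-suc (q a) a)) (trans (sym (q-suc a)) (sym (+-identityʳ _)))

suc-row-end : ∀ p → r p ≡ c p → c (suc p) ≡ suc (c p) × r (suc p) ≡ 0
suc-row-end p rp≡cp =
  subst (λ t → c t ≡ suc (c p) × r t ≡ 0) sp (c-pair {suc (c p)} z≤n , r-pair {suc (c p)} z≤n)
  where
  open ≡-Reasoning
  sp : pair (suc (c p)) 0 ≡ suc p
  sp = begin
    pair (suc (c p)) 0      ≡⟨ sym (suc-diagonal (c p)) ⟩
    suc (pair (c p) (c p))  ≡⟨ cong (λ t → suc (pair (c p) t)) (sym rp≡cp) ⟩
    suc (pair (c p) (r p))  ≡⟨ cong suc (pair-c-r p) ⟩
    suc p                   ∎

larger-r-below : ∀ {u} → suc (r u) < c u → ∃[ w ] w < u × r u < r w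
larger-r-below {u} = go refl
  where
  go : ∀ {a} → a ≡ c u → suc (r u) < a → ∃[ w ] w < u × r u < r w
  go {suc m} m+1≡cu (s≤s 1+ru≤m) =
    pair m m , pair-< ≤-refl (subst (m <_) m+1≡cu (n<1+n m)) ,
    subst (r u <_) (sym (r-pair ≤-refl)) 1+ru≤m

near-diagonal-successor : ∀ {p u} → suc p ≡ u → c p ≤ suc (r p) → c u ≤ suc (r u) → p ≢ 0 →
                          r u ≡ c u
near-diagonal-successor {p} refl cp≤1+rp cu≤1+ru p≢0 with m≤n⇒m<n∨m≡n (r≤c p)
... | inj₁ rp<cp = let (c≡ , r≡) = suc-within-row p rp<cp in
  trans r≡ (trans (≤-antisym rp<cp cp≤1+rp) (sym c≡))
... | inj₂ rp≡cp = ⊥-elim (p≢0 (c-r-injective cp≡0 (trans rp≡cp cp≡0)))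
  where
  cp≡0 : c p ≡ 0
  cp≡0 = let (c≡ , r≡) = suc-row-end p rp≡cp in
    n≤0⇒n≡0 (≤-pred (subst₂ _≤_ c≡ (cong suc r≡) cu≤1+ru))

on-diagonal-cases : ∀ {u} → r u ≡ c u → u ≡ 0 ⊎ ∃[ p ] suc p ≡ u × c p ≡ suc (r p)
on-diagonal-cases {u} ru≡cu = go refl
  where
  go : ∀ {a} → a ≡ c u → u ≡ 0 ⊎ ∃[ p ] suc p ≡ u × c p ≡ suc (r p)
  go {zero}  0≡cu = inj₁ (c-r-injective (sym 0≡cu) (trans ru≡cu (sym 0≡cu)))
  go {suc m} a≡cu =
    inj₂ (pair (suc m) m , suc-p≡u , trans (c-pair (n≤1+n m)) (cong suc (sym (r-pair (n≤1+n m)))))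
    where
    open ≡-Reasoning
    suc-p≡u : suc (pair (suc m) m) ≡ u
    suc-p≡u = begin
      suc (q (suc m) + m)  ≡⟨ sym (+-suc (q (suc m)) m) ⟩
      pair (suc m) (suc m) ≡⟨ cong₂ pair a≡cu (trans a≡cu (sym ru≡cu)) ⟩
      pair (c u) (r u)     ≡⟨ pair-c-r u ⟩
      u                    ∎

row-start⇒pred-on-diagonal : ∀ p → r (suc p) ≡ 0 → r p ≡ c p
row-start⇒pred-on-diagonal p r≡0 with m≤n⇒m<n∨m≡n (r≤c p)
... | inj₁ rp<cp = ⊥-elim (0≢1+n (trans (sym r≡0) (proj₂ (suc-within-row p rp<cp))))
... | inj₂ rp≡cp = rp≡cp

row-start-cases : ∀ {u} → r u ≡ 0 → u ≡ 0 ⊎ ∃[ p ] suc p ≡ u × r p ≡ c p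
row-start-cases {zero}  _   = inj₁ refl
row-start-cases {suc p} r≡0 = inj₂ (p , refl , row-start⇒pred-on-diagonal p r≡0)

row-start-between : ∀ {u v} → c u < c v → u < pair (c v) 0 × pair (c v) 0 ≤ v
row-start-between {u} {v} cu<cv =
  lex⇒< (inj₁ (subst (c u <_) (sym (c-pair {c v} z≤n)) cu<cv)) , pair-≤ ≤-refl z≤n

row-start-pred : ∀ {p s} → suc p ≡ s → r s ≡ 0 → suc (c p) ≡ c s
row-start-pred {p} refl rs≡0 = sym (proj₁ (suc-row-end p (row-start⇒pred-on-diagonal p rs≡0)))

⊏-between-in-row : ∀ {u v} → c u < c v → r u < r v → ∃[ w ] w ≤ v × c w ≡ c v × u ⊏ w × w ⊏ v
⊏-between-in-row {u} {v} cu<cv ru<rv =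
  pair (c v) (r u) , pair-≤ ≤-refl (<⇒≤ ru<rv) , c-pair ru≤cv ,
  inj₂ (sym (r-pair ru≤cv) , subst (c u <_) (sym (c-pair ru≤cv)) cu<cv) ,
  inj₁ (subst (_< r v) (sym (r-pair ru≤cv)) ru<rv)
  where ru≤cv = ≤-trans (r≤c u) (<⇒≤ cu<cv)

no-row-start-inside-row : ∀ {u v s} → c u ≡ c v → r s ≡ 0 → u < s → s ≤ v → ⊥
no-row-start-inside-row {u} {v} {s} cu≡cv rs≡0 u<s s≤v with <⇒lex u<s
... | inj₁ cu<cs      = <⇒≱ cu<cs (subst (c s ≤_) (sym cu≡cv) (c-mono-≤ s≤v))
... | inj₂ (_ , ru<rs) = n≮0 (subst (r u <_) rs≡0 ru<rs)

⊏-not-squeezed : ∀ {u v w} → r u ≡ r v → c w ≡ c v → u ⊏ w → w ⊏ v → ⊥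
⊏-not-squeezed _ cw≡cv _ (inj₂ (_ , cw<cv)) = <-irrefl cw≡cv cw<cv
⊏-not-squeezed {w = w} ru≡rv _ (inj₁ ru<rw) (inj₁ rw<rv) =
  <-asym rw<rv (subst (_< r w) ru≡rv ru<rw)
⊏-not-squeezed ru≡rv _ (inj₂ (ru≡rw , _)) (inj₁ rw<rv) =
  <-irrefl (trans (sym ru≡rw) ru≡rv) rw<rv

row-element : ∀ {a j x} → j < a → a ≤ c x → ∃[ y ] y < x × suc (c y) ≡ a × r y ≡ j
row-element {suc m} {j} (s≤s j≤m) a≤cx =
  pair m j , pair-< j≤m a≤cx , cong suc (c-pair j≤m) , r-pair j≤m

column-element : ∀ z {j} → j ≤ r z → ∃[ e ] e ≤ z × r e ≡ j
column-element z j≤rz = pair (c z) _ , pair-≤ ≤-refl j≤rz , r-pair (≤-trans j≤rz (r≤c z))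

-- Binary addition

odd : ℕ → Bool
odd m = m % 2 ≡ᵇ 1

bit : ℕ → ℕ → Bool
bit x k = odd (x /2^ k)

digit : Bool → ℕ
digit false = 0
digit true  = 1

T-odd⇔¬2∣ : ∀ m → T (odd m) ⇔ (¬ 2 ∣ m)
T-odd⇔¬2∣ m with m % 2 in eq | m%n<n m 2
... | 0           | _ = mk⇔ (λ ()) (λ ¬2∣m → ¬2∣m (m%n≡0⇒n∣m m 2 eq))
... | 1           | _ = mk⇔ (λ _ 2∣m → 0≢1+n (trans (sym (n∣m⇒m%n≡0 m 2 2∣m)) eq)) _
... | suc (suc _) | s≤s (s≤s ())

T-bit⇔BitIs1 : ∀ x k → T (bit x k) ⇔ BitIs1 x k
T-bit⇔BitIs1 x k = T-odd⇔¬2∣ (x /2^ k)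

digit-odd : ∀ m → digit (odd m) ≡ m % 2
digit-odd m with m % 2 | m%n<n m 2
... | 0           | _ = refl
... | 1           | _ = refl
... | suc (suc _) | s≤s (s≤s ())

m≡digit+half : ∀ m → m ≡ digit (odd m) + m / 2 * 2
m≡digit+half m = trans (m≡m%n+[m/n]*n m 2) (cong (_+ m / 2 * 2) (sym (digit-odd m)))

odd-digit+double : ∀ t X → odd (digit t + X * 2) ≡ t
odd-digit+double false X = cong (_≡ᵇ 1) ([m+kn]%n≡m%n 0 X 2)
odd-digit+double true  X = cong (_≡ᵇ 1) ([m+kn]%n≡m%n 1 X 2)

half-digit+double : ∀ t X → (digit t + X * 2) / 2 ≡ X
half-digit+double false X = m*n/n≡m X 2
half-digit+double true  X = trans (+-distrib-/-∣ʳ 1 {X * 2} {2} (divides X refl)) (m*n/n≡m X 2)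

bit-zero : ∀ x → bit x 0 ≡ odd x
bit-zero x = cong odd (n/1≡n x)

bit-suc : ∀ x k → bit x (suc k) ≡ bit (x / 2) k
bit-suc x k = cong odd (sym (m/n/o≡m/[n*o] x 2 (2 ^ k) {{_}} {{m^n≢0 2 k}} {{m^n≢0 2 (suc k)}}))

bit⇒<-exponent : ∀ {x m j} → x < 2 ^ m → T (bit x j) → j < m
bit⇒<-exponent {x} {m} {j} x<2^m bitj with j <? m
... | yes j<m = j<m
... | no j≮m  = ⊥-elim (subst (λ t → T (odd t)) (m<n⇒m/n≡0 {{m^n≢0 2 j}} x<2^j) bitj)
  where x<2^j = <-≤-trans x<2^m (^-monoʳ-≤ 2 (≮⇒≥ j≮m))

n<2^n : ∀ n → n < 2 ^ n
n<2^n zero = z<s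
n<2^n (suc n) = +-mono-≤ (m^n>0 2 n) (≤-trans (n<2^n n) (m≤m+n (2 ^ n) 0))

q<2^n : ∀ n → q n < 2 ^ n
q<2^n zero = z<s
q<2^n (suc n) = subst (_< 2 ^ suc n) (sym (q-suc n))
  (+-mono-≤ (q<2^n n) (≤-trans (n<2^n n) (m≤m+n (2 ^ n) 0)))

maj : Bool → Bool → Bool → Bool
maj true  true  _ = true
maj false false _ = false
maj true  false γ = γ
maj false true  γ = γ

-- The carry into (not out of) position k when adding a, b and the carry-in γ.
carry : ℕ → ℕ → Bool → ℕ → Bool
carry a b γ zero    = γ
carry a b γ (suc k) = maj (bit a k) (bit b k) (carry a b γ k)

full-adder : ∀ α β γ →
  digit α + digit β + digit γ ≡ digit ((α xor β) xor γ) + digit (maj α β γ) * 2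
full-adder true  true  true  = refl
full-adder true  true  false = refl
full-adder true  false true  = refl
full-adder true  false false = refl
full-adder false true  true  = refl
full-adder false true  false = refl
full-adder false false true  = refl
full-adder false false false = refl

add-step : ∀ a b γ → let α = odd a; β = odd b in
  a + b + digit γ ≡ digit ((α xor β) xor γ) + (a / 2 + b / 2 + digit (maj α β γ)) * 2
add-step a b γ = begin
  a + b + digit γ
    ≡⟨ cong₂ (λ a′ b′ → a′ + b′ + digit γ) (m≡digit+half a) (m≡digit+half b) ⟩
  (digit α + a / 2 * 2) + (digit β + b / 2 * 2) + digit γ
    ≡⟨ regroup (digit α) (digit β) (digit γ) (a / 2) (b / 2) ⟩
  (digit α + digit β + digit γ) + (a / 2 + b / 2) * 2
    ≡⟨ cong (_+ (a / 2 + b / 2) * 2) (full-adder α β γ) ⟩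
  digit ((α xor β) xor γ) + digit (maj α β γ) * 2 + (a / 2 + b / 2) * 2
    ≡⟨ absorb (digit ((α xor β) xor γ)) (digit (maj α β γ)) (a / 2) (b / 2) ⟩
  digit ((α xor β) xor γ) + (a / 2 + b / 2 + digit (maj α β γ)) * 2
    ∎
  where
  open ≡-Reasoning
  α = odd a
  β = odd b
  regroup : ∀ x y z A B → (x + A * 2) + (y + B * 2) + z ≡ (x + y + z) + (A + B) * 2
  regroup = solve-∀
  absorb : ∀ s m A B → s + m * 2 + (A + B) * 2 ≡ s + (A + B + m) * 2
  absorb = solve-∀

carry-suc : ∀ a b γ k → carry a b γ (suc k) ≡ carry (a / 2) (b / 2) (maj (odd a) (odd b) γ) k
carry-suc a b γ zero    = cong₂ (λ α β → maj α β γ) (bit-zero a) (bit-zero b)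
carry-suc a b γ (suc k) = cong₃ maj (bit-suc a k) (bit-suc b k) (carry-suc a b γ k)
  where cong₃ : ∀ f {x x′ y y′ z z′} → x ≡ x′ → y ≡ y′ → z ≡ z′ → f x y z ≡ f x′ y′ z′
        cong₃ f refl refl refl = refl

bit-+ : ∀ k a b γ → bit (a + b + digit γ) k ≡ (bit a k xor bit b k) xor carry a b γ k
bit-+ zero a b γ = begin
  bit (a + b + digit γ) 0                       ≡⟨ bit-zero (a + b + digit γ) ⟩
  odd (a + b + digit γ)                         ≡⟨ cong odd (add-step a b γ) ⟩
  odd (digit ((odd a xor odd b) xor γ) + h * 2) ≡⟨ odd-digit+double ((odd a xor odd b) xor γ) h ⟩
  (odd a xor odd b) xor γ
    ≡⟨ cong₂ (λ α β → (α xor β) xor γ) (sym (bit-zero a)) (sym (bit-zero b)) ⟩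
  (bit a 0 xor bit b 0) xor γ                   ∎
  where
  open ≡-Reasoning
  h = a / 2 + b / 2 + digit (maj (odd a) (odd b) γ)
bit-+ (suc k) a b γ = begin
  bit (a + b + digit γ) (suc k)
    ≡⟨ bit-suc (a + b + digit γ) k ⟩
  bit ((a + b + digit γ) / 2) k
    ≡⟨ cong (λ t → bit (t / 2) k) (add-step a b γ) ⟩
  bit ((digit ((odd a xor odd b) xor γ) + h * 2) / 2) k
    ≡⟨ cong (λ t → bit t k) (half-digit+double ((odd a xor odd b) xor γ) h) ⟩
  bit (a / 2 + b / 2 + digit γ′) k
    ≡⟨ bit-+ k (a / 2) (b / 2) γ′ ⟩
  (bit (a / 2) k xor bit (b / 2) k) xor carry′
    ≡⟨ cong₂ (λ α β → (α xor β) xor carry′) (sym (bit-suc a k)) (sym (bit-suc b k)) ⟩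
  (bit a (suc k) xor bit b (suc k)) xor carry′
    ≡⟨ cong ((bit a (suc k) xor bit b (suc k)) xor_) (sym (carry-suc a b γ k)) ⟩
  (bit a (suc k) xor bit b (suc k)) xor carry a b γ (suc k)
    ∎
  where
  open ≡-Reasoning
  γ′ = maj (odd a) (odd b) γ
  h = a / 2 + b / 2 + digit γ′
  carry′ = carry (a / 2) (b / 2) γ′ k

CarryChain : ℕ → ℕ → ℕ → Set
CarryChain a b k = ∃[ j ] j < k × T (bit a j) × T (bit b j) ×
  (∀ m → j < m → m < k → T (bit a m) ⊎ T (bit b m))

carry-chain-extend : ∀ {a b k} → T (bit a k) ⊎ T (bit b k) →
                     CarryChain a b k → CarryChain a b (suc k)
carry-chain-extend {a} {b} {k} propagates (j , j<k , aj , bj , between) =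
  j , m<n⇒m<1+n j<k , aj , bj , between′
  where
  between′ : ∀ m → j < m → m < suc k → T (bit a m) ⊎ T (bit b m)
  between′ m j<m m<1+k with m≤n⇒m<n∨m≡n (≤-pred m<1+k)
  ... | inj₁ m<k  = between m j<m m<k
  ... | inj₂ refl = propagates

maj-generate : ∀ {α β} γ → T α → T β → T (maj α β γ)
maj-generate {true} {true} _ _ _ = _

maj-propagate : ∀ {α β γ} → T α ⊎ T β → T γ → T (maj α β γ)
maj-propagate {true}  {true}  _ _  = _
maj-propagate {true}  {false} _ tγ = tγ
maj-propagate {false} {true}  _ tγ = tγ
maj-propagate {false} {false} (inj₁ ())
maj-propagate {false} {false} (inj₂ ())

carry⇔chain : ∀ a b k → T (carry a b false k) ⇔ CarryChain a b k
carry⇔chain a b k = mk⇔ (carry⇒chain k) (chain⇒carry k)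
  where
  carry⇒chain : ∀ k → T (carry a b false k) → CarryChain a b k
  carry⇒chain zero ()
  carry⇒chain (suc k) carried with bit a k in ak | bit b k in bk
  ... | true  | true  = k , ≤-refl , subst T (sym ak) _ , subst T (sym bk) _ ,
                        λ m k<m m<1+k → ⊥-elim (<⇒≱ k<m (≤-pred m<1+k))
  ... | true  | false = carry-chain-extend (inj₁ (subst T (sym ak) _)) (carry⇒chain k carried)
  ... | false | true  = carry-chain-extend (inj₂ (subst T (sym bk) _)) (carry⇒chain k carried)
  ... | false | false = ⊥-elim carried

  chain⇒carry : ∀ k → CarryChain a b k → T (carry a b false k)
  chain⇒carry zero (_ , () , _)
  chain⇒carry (suc k) (j , j<1+k , aj , bj , between) with m≤n⇒m<n∨m≡n (≤-pred j<1+k)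
  ... | inj₂ refl = maj-generate (carry a b false j) aj bj
  ... | inj₁ j<k  = maj-propagate (between k j<k ≤-refl) (chain⇒carry k (j , j<k , aj , bj , between′))
    where
    between′ : ∀ m → j < m → m < k → T (bit a m) ⊎ T (bit b m)
    between′ m j<m m<k = between m j<m (m<n⇒m<1+n m<k)

bit-triangular : ∀ x k →
  bit x k ≡ (bit (q (c x)) k xor bit (r x) k) xor carry (q (c x)) (r x) false k
bit-triangular x k = begin
  bit x k                              ≡⟨ cong (λ t → bit t k) (sym (pair-c-r x)) ⟩
  bit (q (c x) + r x) k                ≡⟨ cong (λ t → bit t k) (sym (+-identityʳ (q (c x) + r x))) ⟩
  bit (q (c x) + r x + digit false) k  ≡⟨ bit-+ k (q (c x)) (r x) false ⟩
  (bit (q (c x)) k xor bit (r x) k) xor carry (q (c x)) (r x) false k ∎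
  where open ≡-Reasoning

Q⇔bit : ∀ y → Q y ⇔ T (bit (q (suc (c y))) (r y))
Q⇔bit y =
  subst (λ a → Q y ⇔ T (bit (q a) (r y))) (+-comm (c y) 1) (⇔-sym (T-bit⇔BitIs1 (q (c y + 1)) (r y)))

C⇔bit : ∀ y → C y ⇔ T (bit (suc (c y)) (r y))
C⇔bit y =
  subst (λ a → C y ⇔ T (bit a (r y))) (+-comm (c y) 1) (⇔-sym (T-bit⇔BitIs1 (c y + 1) (r y)))

xor-⇔ : ∀ {A B : Set} {α β} → A ⇔ T α → B ⇔ T β → ((A × ¬ B) ⊎ (¬ A × B)) ⇔ T (α xor β)
xor-⇔ {α = true}  {true}  A⇔α B⇔β =
  mk⇔ (λ { (inj₁ (_ , ¬b)) → ¬b (from B⇔β _) ; (inj₂ (¬a , _)) → ¬a (from A⇔α _) }) λ ()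
xor-⇔ {α = true}  {false} A⇔α B⇔β = mk⇔ _ (λ _ → inj₁ (from A⇔α _ , to B⇔β))
xor-⇔ {α = false} {true}  A⇔α B⇔β = mk⇔ _ (λ _ → inj₂ (to A⇔α , from B⇔β _))
xor-⇔ {α = false} {false} A⇔α B⇔β =
  mk⇔ (λ { (inj₁ (a , _)) → to A⇔α a ; (inj₂ (_ , b)) → to B⇔β b }) λ ()

-- First-order definitions over {<, ⊏, C, Q}.

IsZero : ∀ {k} → Fin k → Formula k
IsZero i = ∀' (¬' (fz ≺ fs i))

IsSuc : ∀ {k} → Fin k → Fin k → Formula k
IsSuc i j = (i ≺ j) ∧' (¬' (∃' ((fs i ≺ fz) ∧' (fz ≺ fs j))))

NearDiagonal : ∀ {k} → Fin k → Formula k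
NearDiagonal i = ∀' ((fz ≺ fs i) ⇒' (fz ⊏' fs i))

-- The successor of a diagonal point may lie outside [n], so the diagonal is recognised via predecessors.
OnDiagonal : ∀ {k} → Fin k → Formula k
OnDiagonal i =
  (IsZero i) ∨' ((NearDiagonal i) ∧' (∃' ((IsSuc fz (fs i)) ∧' ((NearDiagonal fz) ∧' (¬' (IsZero fz))))))

RowStart : ∀ {k} → Fin k → Formula k
RowStart i = (IsZero i) ∨' (∃' ((IsSuc fz (fs i)) ∧' (OnDiagonal fz)))

Separates : ∀ {k} → Fin k → Fin k → Fin k → Formula k
Separates s i j = ((i ≺ s) ∧' (¬' (j ≺ s))) ∨' ((j ≺ s) ∧' (¬' (i ≺ s)))

SameRow : ∀ {k} → Fin k → Fin k → Formula k
SameRow i j = ¬' (∃' ((RowStart fz) ∧' (Separates fz (fs i) (fs j))))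

NextRow : ∀ {k} → Fin k → Fin k → Formula k
NextRow i j =
  ∃' ((RowStart fz) ∧' ((SameRow fz (fs j)) ∧' (∃' ((IsSuc fz (fs fz)) ∧' (SameRow (fs (fs i)) fz)))))

EarlierInColumn : ∀ {k} → Fin k → Fin k → Formula k
EarlierInColumn i j =
  (i ≺ j) ∧' ((¬' (SameRow i j)) ∧' ((i ⊏' j) ∧'
    (¬' (∃' ((SameRow fz (fs j)) ∧' ((fs i ⊏' fz) ∧' (fz ⊏' fs j)))))))

SameColumn : ∀ {k} → Fin k → Fin k → Formula k
SameColumn i j = (i ≐ j) ∨' ((EarlierInColumn i j) ∨' (EarlierInColumn j i))

ColumnLess : ∀ {k} → Fin k → Fin k → Formula k
ColumnLess i j = (i ⊏' j) ∧' (¬' (SameColumn i j))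

QBit : ∀ {k} → Fin k → Fin k → Formula k
QBit x w = ∃' ((NextRow fz (fs x)) ∧' ((SameColumn fz (fs w)) ∧' (Q' fz)))

NextRowIsColumn : ∀ {k} → Fin k → Fin k → Formula k
NextRowIsColumn y x = ∃' ((OnDiagonal fz) ∧' ((SameColumn fz (fs x)) ∧' (NextRow (fs y) fz)))

RBit : ∀ {k} → Fin k → Fin k → Formula k
RBit x w = ∃' ((NextRowIsColumn fz (fs x)) ∧' ((SameColumn fz (fs w)) ∧' (C' fz)))

Carry : ∀ {k} → Fin k → Fin k → Formula k
Carry x z = ∃' ((ColumnLess fz (fs z)) ∧' ((QBit (fs x) fz) ∧' ((RBit (fs x) fz) ∧'
  (∀' (((ColumnLess (fs fz) fz) ∧' (ColumnLess fz (fs (fs z)))) ⇒'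
        ((QBit (fs (fs x)) fz) ∨' (RBit (fs (fs x)) fz)))))))

Xor : ∀ {k} → Formula k → Formula k → Formula k
Xor φ ψ = (φ ∧' (¬' ψ)) ∨' ((¬' φ) ∧' ψ)

BitR : Formula 2
BitR = Xor (Xor (QBit fz (fs fz)) (RBit fz (fs fz))) (Carry fz (fs fz))

module Definability (n : ℕ) where

  Defines₁ : (∀ {k} → Fin k → Formula k) → (ℕ → Set) → Set
  Defines₁ φ P = ∀ {k} {ρ : Vec ℕ k} → All (_≤ n) ρ → ∀ i → Sat n ρ (φ i) ⇔ P (lookup ρ i)

  Defines₂ : (∀ {k} → Fin k → Fin k → Formula k) → (ℕ → ℕ → Set) → Set
  Defines₂ φ R = ∀ {k} {ρ : Vec ℕ k} → All (_≤ n) ρ →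
                 ∀ i j → Sat n ρ (φ i j) ⇔ R (lookup ρ i) (lookup ρ j)

  IsZero-defines : Defines₁ IsZero (_≡ 0)
  IsZero-defines {ρ = ρ} _ i =
    mk⇔ (nothing-below⇒0 (lookup ρ i)) (λ u≡0 a _ a<u → n≮0 (subst (a <_) u≡0 a<u))
    where
    nothing-below⇒0 : ∀ u → (∀ a → a ≤ n → ¬ a < u) → u ≡ 0
    nothing-below⇒0 zero    _            = refl
    nothing-below⇒0 (suc _) nothing-below = ⊥-elim (nothing-below 0 z≤n z<s)

  IsSuc-defines : Defines₂ IsSuc (λ u v → suc u ≡ v)
  IsSuc-defines bρ i j = mk⇔ (to′ (lookup⁺ bρ j)) from′
    where
    to′ : ∀ {u v} → v ≤ n → u < v × ¬ (∃[ a ] a ≤ n × u < a × a < v) → suc u ≡ v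
    to′ {u} v≤n (u<v , nothing-between) with m≤n⇒m<n∨m≡n u<v
    ... | inj₂ 1+u≡v = 1+u≡v
    ... | inj₁ 1+u<v = ⊥-elim (nothing-between (suc u , ≤-trans (<⇒≤ 1+u<v) v≤n , ≤-refl , 1+u<v))
    from′ : ∀ {u v} → suc u ≡ v → u < v × ¬ (∃[ a ] a ≤ n × u < a × a < v)
    from′ refl = ≤-refl , λ (a , _ , u<a , a<1+u) → <⇒≱ u<a (≤-pred a<1+u)

  NearDiagonal-defines : Defines₁ NearDiagonal (λ u → c u ≤ suc (r u))
  NearDiagonal-defines bρ i = mk⇔ (to′ (lookup⁺ bρ i)) from′
    where
    to′ : ∀ {u} → u ≤ n → (∀ a → a ≤ n → a < u → a ⊏ u) → c u ≤ suc (r u)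
    to′ {u} u≤n below⊏ with c u ≤? suc (r u)
    ... | yes cu≤1+ru = cu≤1+ru
    ... | no  cu≰1+ru with larger-r-below (≰⇒> cu≰1+ru)
    ...   | w , w<u , ru<rw with below⊏ w (≤-trans (<⇒≤ w<u) u≤n) w<u
    ...     | inj₁ rw<ru       = ⊥-elim (<-asym rw<ru ru<rw)
    ...     | inj₂ (rw≡ru , _) = ⊥-elim (<-irrefl (sym rw≡ru) ru<rw)
    from′ : ∀ {u} → c u ≤ suc (r u) → ∀ a → a ≤ n → a < u → a ⊏ u
    from′ {u} cu≤1+ru a _ a<u with <⇒lex a<u
    ... | inj₂ (_ , ra<ru) = inj₁ ra<ru
    ... | inj₁ ca<cu with m≤n⇒m<n∨m≡n (≤-trans (r≤c a) (≤-pred (≤-trans ca<cu cu≤1+ru)))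
    ...   | inj₁ ra<ru = inj₁ ra<ru
    ...   | inj₂ ra≡ru = inj₂ (ra≡ru , ca<cu)

  OnDiagonal-defines : Defines₁ OnDiagonal (λ u → r u ≡ c u)
  OnDiagonal-defines {ρ = ρ} bρ i = mk⇔ to′ from′
    where
    u = lookup ρ i
    to′ : Sat n ρ (OnDiagonal i) → r u ≡ c u
    to′ (inj₁ isZero) = subst (λ t → r t ≡ c t) (sym (to (IsZero-defines bρ i) isZero)) refl
    to′ (inj₂ (nearU , p , p≤n , isSuc , nearP , p≢0)) =
      near-diagonal-successor (to (IsSuc-defines bρ′ fz (fs i)) isSuc)
        (to (NearDiagonal-defines bρ′ fz) nearP) (to (NearDiagonal-defines bρ i) nearU)
        (λ p≡0 → p≢0 (from (IsZero-defines bρ′ fz) p≡0))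
      where bρ′ = p≤n ∷ bρ
    from′ : r u ≡ c u → Sat n ρ (OnDiagonal i)
    from′ ru≡cu with on-diagonal-cases ru≡cu
    ... | inj₁ u≡0 = inj₁ (from (IsZero-defines bρ i) u≡0)
    ... | inj₂ (p , 1+p≡u , cp≡1+rp) =
      inj₂ (from (NearDiagonal-defines bρ i) (≤-trans (≤-reflexive (sym ru≡cu)) (n≤1+n (r u))) ,
            p , p≤n , from (IsSuc-defines bρ′ fz (fs i)) 1+p≡u ,
            from (NearDiagonal-defines bρ′ fz) (≤-reflexive cp≡1+rp) ,
            λ isZero → 0≢1+n (trans (sym (cong c (to (IsZero-defines bρ′ fz) isZero))) cp≡1+rp))
      where
      p≤n = ≤-trans (n≤1+n p) (subst (_≤ n) (sym 1+p≡u) (lookup⁺ bρ i))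
      bρ′ = p≤n ∷ bρ

  RowStart-defines : Defines₁ RowStart (λ u → r u ≡ 0)
  RowStart-defines {ρ = ρ} bρ i = mk⇔ to′ from′
    where
    u = lookup ρ i
    to′ : Sat n ρ (RowStart i) → r u ≡ 0
    to′ (inj₁ isZero) = subst (λ t → r t ≡ 0) (sym (to (IsZero-defines bρ i) isZero)) refl
    to′ (inj₂ (p , p≤n , isSuc , diagP)) =
      subst (λ t → r t ≡ 0) (to (IsSuc-defines bρ′ fz (fs i)) isSuc)
        (proj₂ (suc-row-end p (to (OnDiagonal-defines bρ′ fz) diagP)))
      where bρ′ = p≤n ∷ bρ
    from′ : r u ≡ 0 → Sat n ρ (RowStart i)
    from′ ru≡0 with row-start-cases ru≡0
    ... | inj₁ u≡0 = inj₁ (from (IsZero-defines bρ i) u≡0)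
    ... | inj₂ (p , 1+p≡u , rp≡cp) =
      inj₂ (p , p≤n , from (IsSuc-defines bρ′ fz (fs i)) 1+p≡u , from (OnDiagonal-defines bρ′ fz) rp≡cp)
      where
      p≤n = ≤-trans (n≤1+n p) (subst (_≤ n) (sym 1+p≡u) (lookup⁺ bρ i))
      bρ′ = p≤n ∷ bρ

  SameRow-defines : Defines₂ SameRow (λ u v → c u ≡ c v)
  SameRow-defines {ρ = ρ} bρ i j = mk⇔ to′ from′
    where
    u = lookup ρ i
    v = lookup ρ j
    start-of : ∀ x → x ≤ n → Sat n (pair (c x) 0 ∷ ρ) (RowStart fz)
    start-of x x≤n = from (RowStart-defines (≤-trans (pair-≤ ≤-refl z≤n) x≤n ∷ bρ) fz) (r-pair {c x} z≤n)
    to′ : Sat n ρ (SameRow i j) → c u ≡ c v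
    to′ none with <-cmp (c u) (c v)
    ... | tri≈ _ cu≡cv _ = cu≡cv
    ... | tri< cu<cv _ _ = let (u<s , s≤v) = row-start-between cu<cv in
      ⊥-elim (none (_ , ≤-trans s≤v (lookup⁺ bρ j) , start-of v (lookup⁺ bρ j) , inj₁ (u<s , ≤⇒≯ s≤v)))
    ... | tri> _ _ cv<cu = let (v<s , s≤u) = row-start-between cv<cu in
      ⊥-elim (none (_ , ≤-trans s≤u (lookup⁺ bρ i) , start-of u (lookup⁺ bρ i) , inj₂ (v<s , ≤⇒≯ s≤u)))
    from′ : c u ≡ c v → Sat n ρ (SameRow i j)
    from′ cu≡cv (s , s≤n , start , inj₁ (u<s , v≮s)) =
      no-row-start-inside-row cu≡cv (to (RowStart-defines (s≤n ∷ bρ) fz) start) u<s (≮⇒≥ v≮s)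
    from′ cu≡cv (s , s≤n , start , inj₂ (v<s , u≮s)) =
      no-row-start-inside-row (sym cu≡cv) (to (RowStart-defines (s≤n ∷ bρ) fz) start) v<s (≮⇒≥ u≮s)

  NextRow-defines : Defines₂ NextRow (λ u v → suc (c u) ≡ c v)
  NextRow-defines {ρ = ρ} bρ i j = mk⇔ to′ from′
    where
    u = lookup ρ i
    v = lookup ρ j
    to′ : Sat n ρ (NextRow i j) → suc (c u) ≡ c v
    to′ (s , s≤n , start , sameSV , p , p≤n , isSuc , sameUP) =
      trans (cong suc (to (SameRow-defines bρ″ (fs (fs i)) fz) sameUP))
        (trans (row-start-pred (to (IsSuc-defines bρ″ fz (fs fz)) isSuc) (to (RowStart-defines bρ′ fz) start))
               (to (SameRow-defines bρ′ fz (fs j)) sameSV))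
      where
      bρ′ = s≤n ∷ bρ
      bρ″ = p≤n ∷ bρ′
    from′ : suc (c u) ≡ c v → Sat n ρ (NextRow i j)
    from′ 1+cu≡cv =
      s , s≤n , from (RowStart-defines bρ′ fz) (r-pair {c v} z≤n) ,
      from (SameRow-defines bρ′ fz (fs j)) (c-pair {c v} z≤n) ,
      p , p≤n , from (IsSuc-defines bρ″ fz (fs fz)) 1+p≡s ,
      from (SameRow-defines bρ″ (fs (fs i)) fz) (sym (c-pair ≤-refl))
      where
      s = pair (c v) 0
      p = pair (c u) (c u)
      s≤n = ≤-trans (pair-≤ ≤-refl z≤n) (lookup⁺ bρ j)
      1+p≡s = trans (suc-diagonal (c u)) (cong (λ a → pair a 0) 1+cu≡cv)
      p≤n = ≤-trans (n≤1+n p) (subst (_≤ n) (sym 1+p≡s) s≤n)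
      bρ′ = s≤n ∷ bρ
      bρ″ = p≤n ∷ bρ′

  EarlierInColumn-defines : Defines₂ EarlierInColumn (λ u v → c u < c v × r u ≡ r v)
  EarlierInColumn-defines {ρ = ρ} bρ i j = mk⇔ to′ from′
    where
    u = lookup ρ i
    v = lookup ρ j
    to′ : Sat n ρ (EarlierInColumn i j) → c u < c v × r u ≡ r v
    to′ (u<v , ¬sameRow , u⊏v , nothing-between) = cu<cv , same-r u⊏v
      where
      cu<cv = ≤∧≢⇒< (c-mono-≤ (<⇒≤ u<v)) (λ cu≡cv → ¬sameRow (from (SameRow-defines bρ i j) cu≡cv))
      same-r : u ⊏ v → r u ≡ r v
      same-r (inj₂ (ru≡rv , _)) = ru≡rv
      same-r (inj₁ ru<rv) with ⊏-between-in-row {u} {v} cu<cv ru<rv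
      ... | w , w≤v , cw≡cv , u⊏w , w⊏v = ⊥-elim (nothing-between
              (w , w≤n , from (SameRow-defines (w≤n ∷ bρ) fz (fs j)) cw≡cv , u⊏w , w⊏v))
        where w≤n = ≤-trans w≤v (lookup⁺ bρ j)
    from′ : c u < c v × r u ≡ r v → Sat n ρ (EarlierInColumn i j)
    from′ (cu<cv , ru≡rv) =
      lex⇒< (inj₁ cu<cv) , (λ sameRow → <-irrefl (to (SameRow-defines bρ i j) sameRow) cu<cv) ,
      inj₂ (ru≡rv , cu<cv) ,
      λ (w , w≤n , sameRow , u⊏w , w⊏v) →
        ⊏-not-squeezed {u} {v} {w} ru≡rv (to (SameRow-defines (w≤n ∷ bρ) fz (fs j)) sameRow) u⊏w w⊏v

  SameColumn-defines : Defines₂ SameColumn (λ u v → r u ≡ r v)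
  SameColumn-defines {ρ = ρ} bρ i j = mk⇔ to′ from′
    where
    u = lookup ρ i
    v = lookup ρ j
    to′ : Sat n ρ (SameColumn i j) → r u ≡ r v
    to′ (inj₁ u≡v)         = cong r u≡v
    to′ (inj₂ (inj₁ u↑v)) = proj₂ (to (EarlierInColumn-defines bρ i j) u↑v)
    to′ (inj₂ (inj₂ v↑u)) = sym (proj₂ (to (EarlierInColumn-defines bρ j i) v↑u))
    from′ : r u ≡ r v → Sat n ρ (SameColumn i j)
    from′ ru≡rv with <-cmp (c u) (c v)
    ... | tri≈ _ cu≡cv _ = inj₁ (c-r-injective cu≡cv ru≡rv)
    ... | tri< cu<cv _ _ = inj₂ (inj₁ (from (EarlierInColumn-defines bρ i j) (cu<cv , ru≡rv)))
    ... | tri> _ _ cv<cu = inj₂ (inj₂ (from (EarlierInColumn-defines bρ j i) (cv<cu , sym ru≡rv)))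

  ColumnLess-defines : Defines₂ ColumnLess (λ u v → r u < r v)
  ColumnLess-defines {ρ = ρ} bρ i j = mk⇔ to′ from′
    where
    to′ : Sat n ρ (ColumnLess i j) → r (lookup ρ i) < r (lookup ρ j)
    to′ (inj₁ ru<rv , _)              = ru<rv
    to′ (inj₂ (ru≡rv , _) , ¬sameCol) = ⊥-elim (¬sameCol (from (SameColumn-defines bρ i j) ru≡rv))
    from′ : r (lookup ρ i) < r (lookup ρ j) → Sat n ρ (ColumnLess i j)
    from′ ru<rv = inj₁ ru<rv , λ sameCol → <-irrefl (to (SameColumn-defines bρ i j) sameCol) ru<rv

  QBit-defines : Defines₂ QBit (λ x w → T (bit (q (c x)) (r w)))
  QBit-defines {ρ = ρ} bρ i j = mk⇔ to′ from′
    where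
    x = lookup ρ i
    w = lookup ρ j
    to′ : Sat n ρ (QBit i j) → T (bit (q (c x)) (r w))
    to′ (y , y≤n , nextRow , sameCol , Qy) =
      subst₂ (λ a b → T (bit (q a) b)) (to (NextRow-defines bρ′ fz (fs i)) nextRow)
        (to (SameColumn-defines bρ′ fz (fs j)) sameCol) (to (Q⇔bit y) Qy)
      where bρ′ = y≤n ∷ bρ
    from′ : T (bit (q (c x)) (r w)) → Sat n ρ (QBit i j)
    from′ bit-set with row-element (bit⇒<-exponent (q<2^n (c x)) bit-set) ≤-refl
    ... | y , y<x , 1+cy≡cx , ry≡rw =
      y , y≤n , from (NextRow-defines bρ′ fz (fs i)) 1+cy≡cx ,
      from (SameColumn-defines bρ′ fz (fs j)) ry≡rw ,
      from (Q⇔bit y) (subst₂ (λ a b → T (bit (q a) b)) (sym 1+cy≡cx) (sym ry≡rw) bit-set)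
      where
      y≤n = ≤-trans (<⇒≤ y<x) (lookup⁺ bρ i)
      bρ′ = y≤n ∷ bρ

  NextRowIsColumn-defines : Defines₂ NextRowIsColumn (λ y x → suc (c y) ≡ r x)
  NextRowIsColumn-defines {ρ = ρ} bρ i j = mk⇔ to′ from′
    where
    y = lookup ρ i
    x = lookup ρ j
    to′ : Sat n ρ (NextRowIsColumn i j) → suc (c y) ≡ r x
    to′ (d , d≤n , onDiag , sameCol , nextRow) =
      trans (to (NextRow-defines bρ′ (fs i) fz) nextRow)
        (trans (sym (to (OnDiagonal-defines bρ′ fz) onDiag)) (to (SameColumn-defines bρ′ fz (fs j)) sameCol))
      where bρ′ = d≤n ∷ bρ
    from′ : suc (c y) ≡ r x → Sat n ρ (NextRowIsColumn i j)
    from′ 1+cy≡rx =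
      d , d≤n , from (OnDiagonal-defines bρ′ fz) (trans rd≡rx (sym cd≡rx)) ,
      from (SameColumn-defines bρ′ fz (fs j)) rd≡rx ,
      from (NextRow-defines bρ′ (fs i) fz) (trans 1+cy≡rx (sym cd≡rx))
      where
      d = pair (r x) (r x)
      cd≡rx = c-pair ≤-refl
      rd≡rx = r-pair ≤-refl
      d≤n = ≤-trans (pair-≤ (r≤c x) ≤-refl) (lookup⁺ bρ j)
      bρ′ = d≤n ∷ bρ

  RBit-defines : Defines₂ RBit (λ x w → T (bit (r x) (r w)))
  RBit-defines {ρ = ρ} bρ i j = mk⇔ to′ from′
    where
    x = lookup ρ i
    w = lookup ρ j
    to′ : Sat n ρ (RBit i j) → T (bit (r x) (r w))
    to′ (y , y≤n , nextRowIsCol , sameCol , Cy) =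
      subst₂ (λ a b → T (bit a b)) (to (NextRowIsColumn-defines bρ′ fz (fs i)) nextRowIsCol)
        (to (SameColumn-defines bρ′ fz (fs j)) sameCol) (to (C⇔bit y) Cy)
      where bρ′ = y≤n ∷ bρ
    from′ : T (bit (r x) (r w)) → Sat n ρ (RBit i j)
    from′ bit-set with row-element (bit⇒<-exponent (n<2^n (r x)) bit-set) (r≤c x)
    ... | y , y<x , 1+cy≡rx , ry≡rw =
      y , y≤n , from (NextRowIsColumn-defines bρ′ fz (fs i)) 1+cy≡rx ,
      from (SameColumn-defines bρ′ fz (fs j)) ry≡rw ,
      from (C⇔bit y) (subst₂ (λ a b → T (bit a b)) (sym 1+cy≡rx) (sym ry≡rw) bit-set)
      where
      y≤n = ≤-trans (<⇒≤ y<x) (lookup⁺ bρ i)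
      bρ′ = y≤n ∷ bρ

  Carry-defines : Defines₂ Carry (λ x z → CarryChain (q (c x)) (r x) (r z))
  Carry-defines {ρ = ρ} bρ i j = mk⇔ to′ from′
    where
    x = lookup ρ i
    z = lookup ρ j
    to′ : Sat n ρ (Carry i j) → CarryChain (q (c x)) (r x) (r z)
    to′ (w , w≤n , rw<rz , qbit , rbit , between) =
      r w , to (ColumnLess-defines bρ′ fz (fs j)) rw<rz ,
      to (QBit-defines bρ′ (fs i) fz) qbit , to (RBit-defines bρ′ (fs i) fz) rbit , between′
      where
      bρ′ = w≤n ∷ bρ
      between′ : ∀ m → r w < m → m < r z → T (bit (q (c x)) m) ⊎ T (bit (r x) m)
      between′ m rw<m m<rz with column-element z (<⇒≤ m<rz)
      ... | e , e≤z , refl =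
        Sum.map (to (QBit-defines bρ″ (fs (fs i)) fz)) (to (RBit-defines bρ″ (fs (fs i)) fz))
          (between e e≤n (from (ColumnLess-defines bρ″ (fs fz) fz) rw<m ,
                          from (ColumnLess-defines bρ″ fz (fs (fs j))) m<rz))
        where
        e≤n = ≤-trans e≤z (lookup⁺ bρ j)
        bρ″ = e≤n ∷ bρ′
    from′ : CarryChain (q (c x)) (r x) (r z) → Sat n ρ (Carry i j)
    from′ (m , m<rz , qbit , rbit , between) with column-element z (<⇒≤ m<rz)
    ... | w , w≤z , refl =
      w , w≤n , from (ColumnLess-defines bρ′ fz (fs j)) m<rz ,
      from (QBit-defines bρ′ (fs i) fz) qbit , from (RBit-defines bρ′ (fs i) fz) rbit ,
      λ e e≤n (rw<re , re<rz) → let bρ″ = e≤n ∷ bρ′ in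
        Sum.map (from (QBit-defines bρ″ (fs (fs i)) fz)) (from (RBit-defines bρ″ (fs (fs i)) fz))
          (between (r e) (to (ColumnLess-defines bρ″ (fs fz) fz) rw<re)
                         (to (ColumnLess-defines bρ″ fz (fs (fs j))) re<rz))
      where
      w≤n = ≤-trans w≤z (lookup⁺ bρ j)
      bρ′ = w≤n ∷ bρ

  BitR-defines : ∀ {x z} → x ≤ n → z ≤ n → Sat n (x ∷ z ∷ []) BitR ⇔ BitIs1 x (r z)
  BitR-defines {x} {z} x∈[n] z∈[n] = ⇔-trans sat⇔xor xor⇔bit
    where
    bρ = x∈[n] ∷ z∈[n] ∷ []
    carry⇔sat = ⇔-trans (Carry-defines bρ fz (fs fz)) (⇔-sym (carry⇔chain (q (c x)) (r x) (r z)))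
    sat⇔xor = xor-⇔ (xor-⇔ (QBit-defines bρ fz (fs fz)) (RBit-defines bρ fz (fs fz))) carry⇔sat
    xor⇔bit = subst (λ b → T b ⇔ BitIs1 x (r z)) (bit-triangular x (r z)) (T-bit⇔BitIs1 x (r z))

lemma3p5 : Σ (Formula 2) (λ φ → (n x z : ℕ) → x ≤ n → z ≤ n → (Sat n (x ∷ z ∷ []) φ ⇔ BitIs1 x (r z)))
lemma3p5 = BitR , λ n x z → Definability.BitR-defines n
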